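{- Let $p_1,p_2\geq 3$ be primes. Then for every finite Abelian group $\Gamma$ of order $p_1p_2$ there exists a $\Gamma$-magic rectangle $\mathrm{MR}_{\Gamma}(p_1,p_2)$.
   Context: All groups are Abelian, written additively. For a finite Abelian group $\Gamma$ of order $ab$, a $\Gamma$-magic rectangle $\mathrm{MR}_{\Gamma}(a,b)$ is an $a\times b$ array whose entries are the elements of $\Gamma$, each appearing exactly once, such that all row sums equal a common constant $\omega\in\Gamma$ and all column sums equal a common constant $\delta\in\Gamma$. -}

module Defs where

open import Level using (Level)
open import Algebra.Bundles using (AbelianGroup)
open import Data.Nat using (ℕ; _*_)
open import Data.Fin using (Fin)
open import Data.Product using (_×_; _,_; proj₁; proj₂)
open import Function.Definitions using (Bijective)
open import Relation.Binary.PropositionalEquality using (_≡_)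
open import Function.Bundles using (Bijection)
import Relation.Binary.PropositionalEquality as ≡
import Data.Vec.Functional as VF

module _ {c ℓ : Level} (Γ : AbelianGroup c ℓ) where
  open AbelianGroup Γ

  gsum : ∀ {n} → (Fin n → Carrier) → Carrier
  gsum = VF.foldr _∙_ ε

  HasOrder : ℕ → Set _
  HasOrder n = Bijection (≡.setoid (Fin n)) setoid

  record MagicRectangle (a b : ℕ) : Set (c Level.⊔ ℓ) where
    field
      entry      : Fin a → Fin b → Carrier
      bijective  : Bijective _≡_ _≈_ (λ (p : Fin a × Fin b) → entry (proj₁ p) (proj₂ p))
      ω          : Carrier
      δ          : Carrier
      rowSums    : ∀ i → gsum (λ j → entry i j) ≈ ω
      columnSums : ∀ j → gsum (λ i → entry i j) ≈ δ

module Submission where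

-- Write |Γ| = ab. We pick g, h ∈ Γ and lay out entries I·g + J·h with coefficients
-- I, J depending on the position (r , c); the entries are pairwise distinct, hence by
-- counting exhaust Γ, and the coefficient sums along lines are controlled.
--  * a = b = p: if p·y ≠ ε for some y take g = p·y, h = y; otherwise Γ has exponent p
--    and we take g ≠ ε, h ∉ ⟨g⟩. Entry (r , c) = r·g + ((r + c) mod p)·h.
--  * a ≠ b: g, h of orders a, b exist (if b killed Γ, an independent pair would span a
--    subgroup of order b² and Lagrange would give b² ∣ ab). Entry (r , c) =
--    (r·w c)·g + (c·z r)·h with unit weights w (mod a), z (mod b) whose sums vanish, so
--    all line sums are ε. This needs a ∤ b − 1; otherwise b ∤ a − 1 and we transpose.

open import Level using (Level)
open import Algebra.Bundles using (AbelianGroup)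
open import Data.Nat as ℕ
  using (ℕ; zero; suc; _+_; _*_; _∸_; _≤_; _<_; z≤n; s≤s; NonZero; _%_; _/_; _≟_; nonTrivial⇒n>1; nonTrivial⇒≢1)
import Data.Nat.Properties as NP
open import Data.Nat.Divisibility
  using (_∣_; _∣?_; divides; m%n≡0⇒n∣m; ∣m⇒∣m*n; ∣n⇒∣m*n; ∣⇒≤; m∣m*n; *-cancelʳ-∣)
open import Data.Nat.DivMod using (m≡m%n+[m/n]*n; m%n<n; m%n≤n; %-distribˡ-+; m%n%n≡m%n; [m+n]%n≡m%n; m<n⇒m%n≡m)
open import Data.Nat.Primality using (Prime; prime⇒irreducible; prime⇒nonZero; prime⇒nonTrivial)
open import Data.Nat.Coprimality using (Coprime; coprime-Bézout; prime⇒coprime; 1-coprimeTo) renaming (sym to coprime-sym)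
open import Data.Nat.GCD using (module Bézout)
open import Data.Nat.Tactic.RingSolver using (solve-∀)
open import Data.Fin as Fin using (Fin; toℕ; zero; suc; fromℕ<; punchOut; remQuot; combine)
import Data.Fin.Properties as FP
open import Data.Fin.Permutation using (Permutation; permutation)
open import Data.Vec.Functional using (_∷_)
open import Data.Product using (_×_; _,_; ∃; proj₁; proj₂)
open import Data.Sum using (_⊎_; inj₁; inj₂)
open import Data.Empty using (⊥-elim)
open import Function using (_∘_)
open import Function.Bundles using (Bijection)
open import Function.Definitions using (Injective; Surjective; Bijective)
open import Relation.Nullary using (¬_; Dec; yes; no)
open import Relation.Nullary.Decidable using (map′)
open import Relation.Binary.Definitions using (Decidable)
open import Relation.Binary.PropositionalEquality as ≡ using (_≡_; _≢_)
import Algebra.Properties.Semiring.Sum NP.+-*-semiring as ℕΣ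
open import Defs

module Arithmetic where
  open ≡ using (refl; sym; trans; cong; cong₂)
  open ≡.≡-Reasoning

  Σℕ : ∀ {n} → (Fin n → ℕ) → ℕ
  Σℕ = ℕΣ.sum

  Σ-const : ∀ n x → Σℕ {n} (λ _ → x) ≡ n * x
  Σ-const zero    x = refl
  Σ-const (suc n) x = cong (x +_) (Σ-const n x)

  triangle : ∀ n → Σℕ {n} toℕ * 2 + n ≡ n * n
  triangle zero    = refl
  triangle (suc n) = begin
    Σℕ {n} (λ i → 1 + toℕ i) * 2 + suc n
      ≡⟨ cong (λ s → s * 2 + suc n) (ℕΣ.∑-distrib-+ {n} (λ _ → 1) toℕ) ⟩
    (Σℕ {n} (λ _ → 1) + T) * 2 + suc n
      ≡⟨ cong (λ s → (s + T) * 2 + suc n) (trans (Σ-const n 1) (NP.*-identityʳ n)) ⟩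
    (n + T) * 2 + suc n                    ≡⟨ shift n T ⟩
    (T * 2 + n) + suc (n + n)              ≡⟨ cong (_+ suc (n + n)) (triangle n) ⟩
    n * n + suc (n + n)                    ≡⟨ square n ⟩
    suc n * suc n                          ∎
    where
      T : ℕ
      T = Σℕ {n} toℕ
      shift : ∀ n T → (n + T) * 2 + suc n ≡ (T * 2 + n) + suc (n + n)
      shift = solve-∀
      square : ∀ n → n * n + suc (n + n) ≡ suc n * suc n
      square = solve-∀

  ∣-Σ-*ˡ : ∀ {m n} x (f : Fin n → ℕ) → m ∣ Σℕ f → m ∣ Σℕ (λ i → x * f i)
  ∣-Σ-*ˡ x f m∣Σf = ≡.subst (_ ∣_) (ℕΣ.*-distribˡ-sum x f) (∣n⇒∣m*n x m∣Σf)

  ∣-Σ-*ʳ : ∀ {m n} x (f : Fin n → ℕ) → m ∣ Σℕ f → m ∣ Σℕ (λ i → f i * x)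
  ∣-Σ-*ʳ x f m∣Σf = ≡.subst (_ ∣_) (ℕΣ.*-distribʳ-sum x f) (∣m⇒∣m*n x m∣Σf)

  fin-injective⇒surjective : ∀ {n} (f : Fin n → Fin n) → Injective _≡_ _≡_ f → ∀ y → ∃ λ x → f x ≡ y
  fin-injective⇒surjective {zero}  f f-injective ()
  fin-injective⇒surjective {suc n} f f-injective y with FP.any? (λ x → f x FP.≟ y)
  ... | yes hit  = hit
  ... | no  miss = ⊥-elim (NP.<-irrefl refl (FP.injective⇒≤ {f = avoid} avoid-injective))
    where
      y≢f : ∀ x → y ≢ f x
      y≢f x y≡fx = miss (x , sym y≡fx)
      avoid : Fin (suc n) → Fin n
      avoid x = punchOut (y≢f x)
      avoid-injective : Injective _≡_ _≡_ avoid
      avoid-injective {x} {x′} eq = f-injective (FP.punchOut-injective (y≢f x) (y≢f x′) eq)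

  Σ-reindex : ∀ {n} (f : Fin n → Fin n) → Injective _≡_ _≡_ f → (g : Fin n → ℕ) →
              Σℕ (λ x → g (f x)) ≡ Σℕ g
  Σ-reindex {n} f f-injective g = sym (ℕΣ.sum-permute g π)
    where
      f⁻¹ : Fin n → Fin n
      f⁻¹ y = proj₁ (fin-injective⇒surjective f f-injective y)
      π : Permutation n n
      π = permutation f f⁻¹ (λ y → proj₂ (fin-injective⇒surjective f f-injective y))
                            (λ x → f-injective (proj₂ (fin-injective⇒surjective f f-injective (f x))))

  Odd≥3 : ℕ → Set
  Odd≥3 n = ∃ λ k → n ≡ 3 + k * 2

  odd⇒∣triangle : ∀ {n} → Odd≥3 n → n ∣ Σℕ {n} toℕ
  odd⇒∣triangle (k′ , refl) = divides k (NP.*-cancelʳ-≡ _ _ 2 (NP.+-cancelʳ-≡ n _ _ (begin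
    Σℕ {n} toℕ * 2 + n     ≡⟨ triangle n ⟩
    n * n                  ≡⟨ expand k ⟩
    k * n * 2 + n          ∎)))
    where
      k n : ℕ
      k = suc k′
      n = suc (k * 2)
      expand : ∀ k → suc (k * 2) * suc (k * 2) ≡ k * suc (k * 2) * 2 + suc (k * 2)
      expand = solve-∀

  odd-prime : ∀ {p} → Prime p → 3 ≤ p → Odd≥3 p
  odd-prime {p} p-prime 3≤p with p % 2 in rem | m%n<n p 2
  ... | 0 | _ = ⊥-elim (2≢p (two-divides (prime⇒irreducible p-prime (m%n≡0⇒n∣m p 2 rem))))
    where
      two-divides : 2 ≡ 1 ⊎ 2 ≡ p → 2 ≡ p
      two-divides (inj₁ ())
      two-divides (inj₂ 2≡p) = 2≡p
      2≢p : 2 ≢ p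
      2≢p refl = NP.<-irrefl refl 3≤p
  ... | 1 | _ = quotient (p / 2) (trans (m≡m%n+[m/n]*n p 2) (cong (_+ p / 2 * 2) rem))
    where
      3≰1 : ¬ 3 ≤ 1
      3≰1 (s≤s ())
      quotient : ∀ q → p ≡ 1 + q * 2 → Odd≥3 p
      quotient zero    eq = ⊥-elim (3≰1 (NP.≤-trans 3≤p (NP.≤-reflexive eq)))
      quotient (suc k) eq = k , eq
  ... | suc (suc _) | s≤s (s≤s ())

  prime>1 : ∀ {p} → Prime p → 1 < p
  prime>1 {p} p-prime = nonTrivial⇒n>1 p {{prime⇒nonTrivial p-prime}}

  -- x lies strictly between 0 and m (for prime m: a unit modulo m)
  Between : ℕ → ℕ → Set
  Between m x = 0 < x × x < m

  ∸-between : ∀ {m r} → Between m r → Between m (m ∸ r)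
  ∸-between {m} {r} (0<r , r<m) = NP.m<n⇒0<n∸m r<m , NP.∸-monoʳ-< {m} {r} {0} 0<r (NP.<⇒≤ r<m)

  unit⇒coprime : ∀ {p d} → Prime p → Between p d → Coprime p d
  unit⇒coprime p-prime (0<d , d<p) = prime⇒coprime p-prime {{ℕ.>-nonZero 0<d}} d<p

  distinct-primes-coprime : ∀ {p q} → Prime p → Prime q → p ≢ q → Coprime p q
  distinct-primes-coprime {p} {q} p-prime q-prime p≢q {d} (d∣p , d∣q) with prime⇒irreducible p-prime d∣p
  ... | inj₁ d≡1 = d≡1
  ... | inj₂ d≡p with prime⇒irreducible q-prime d∣q
  ...   | inj₁ d≡1 = d≡1
  ...   | inj₂ d≡q = ⊥-elim (p≢q (≡.trans (≡.sym d≡p) d≡q))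

  prime-divisor : ∀ {q p} → Prime q → Prime p → q ∣ p → q ≡ p
  prime-divisor q-prime p-prime q∣p with prime⇒irreducible p-prime q∣p
  ... | inj₁ q≡1 = ⊥-elim (nonTrivial⇒≢1 {{prime⇒nonTrivial q-prime}} q≡1)
  ... | inj₂ q≡p = q≡p

  -- a ∣ b − 1 and b ∣ a − 1 cannot both hold for a, b ≥ 2 (each would be smaller than the other)
  ∣-pred-asymmetric : ∀ {a b} → 2 ≤ a → 2 ≤ b → a ∣ (b ∸ 1) → ¬ b ∣ (a ∸ 1)
  ∣-pred-asymmetric {suc (suc a)} {suc (suc b)} (s≤s (s≤s _)) (s≤s (s≤s _)) a∣b-1 b∣a-1 =
    NP.<-asym (s≤s (∣⇒≤ a∣b-1)) (s≤s (∣⇒≤ b∣a-1))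

  alternating : ℕ → ℕ → ℕ
  alternating m zero          = 1
  alternating m (suc zero)    = m ∸ 1
  alternating m (suc (suc i)) = alternating m i

  Σ-alternating : ∀ {m} → 1 ≤ m → ∀ k → Σℕ {k * 2} (λ i → alternating m (toℕ i)) ≡ k * m
  Σ-alternating         1≤m zero    = refl
  Σ-alternating {m} 1≤m (suc k) = begin
    1 + (m ∸ 1 + Σℕ {k * 2} (λ i → alternating m (toℕ i)))  ≡⟨ sym (NP.+-assoc 1 (m ∸ 1) _) ⟩
    1 + (m ∸ 1) + Σℕ {k * 2} (λ i → alternating m (toℕ i))
      ≡⟨ cong₂ _+_ (NP.m+[n∸m]≡n 1≤m) (Σ-alternating 1≤m k) ⟩
    m + k * m                                               ∎

  -- 1, 1, m − 2, 1, m − 1, 1, m − 1, …: an odd number of units modulo m with sum ≡ 0 (mod m)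
  unit-weights : ℕ → ℕ → ℕ
  unit-weights m zero                = 1
  unit-weights m (suc zero)          = 1
  unit-weights m (suc (suc zero))    = m ∸ 2
  unit-weights m (suc (suc (suc i))) = alternating m i

  Σ-unit-weights : ∀ {m n} → 2 ≤ m → Odd≥3 n → m ∣ Σℕ {n} (λ i → unit-weights m (toℕ i))
  Σ-unit-weights {m} 2≤m (k , refl) = divides (suc k) (begin
    1 + (1 + (m ∸ 2 + Σℕ {k * 2} (λ i → alternating m (toℕ i))))  ≡⟨ sym (NP.+-assoc 2 (m ∸ 2) _) ⟩
    2 + (m ∸ 2) + Σℕ {k * 2} (λ i → alternating m (toℕ i))
      ≡⟨ cong₂ _+_ (NP.m+[n∸m]≡n 2≤m) (Σ-alternating (NP.≤-trans (s≤s z≤n) 2≤m) k) ⟩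
    m + k * m                                                     ∎)

  unit-weights-between : ∀ {m} → 3 ≤ m → ∀ i → Between m (unit-weights m i)
  unit-weights-between 3≤m zero                = s≤s z≤n , NP.<-≤-trans (s≤s (s≤s z≤n)) 3≤m
  unit-weights-between 3≤m (suc zero)          = unit-weights-between 3≤m zero
  unit-weights-between 3≤m (suc (suc zero))    = ∸-between (s≤s z≤n , 3≤m)
  unit-weights-between 3≤m (suc (suc (suc i))) = alternating-between i
    where
      alternating-between : ∀ i → Between _ (alternating _ i)
      alternating-between zero          = unit-weights-between 3≤m zero
      alternating-between (suc zero)    = ∸-between (unit-weights-between 3≤m zero)
      alternating-between (suc (suc i)) = alternating-between i

  corrected-ones : (a b : ℕ) .{{_ : NonZero a}} → Fin b → ℕ
  corrected-ones a b zero    = a ∸ (b ∸ 1) % a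
  corrected-ones a b (suc _) = 1

  Σ-corrected-ones : ∀ a b .{{_ : NonZero a}} → a ∣ Σℕ (corrected-ones a (suc b))
  Σ-corrected-ones a b = divides (suc (b / a)) (begin
    a ∸ b % a + Σℕ {b} (λ _ → 1)         ≡⟨ cong (a ∸ b % a +_) (trans (Σ-const b 1) (NP.*-identityʳ b)) ⟩
    a ∸ b % a + b                        ≡⟨ cong (a ∸ b % a +_) (m≡m%n+[m/n]*n b a) ⟩
    a ∸ b % a + (b % a + b / a * a)      ≡⟨ sym (NP.+-assoc (a ∸ b % a) _ _) ⟩
    a ∸ b % a + b % a + b / a * a        ≡⟨ cong (_+ b / a * a) (NP.m∸n+n≡m (m%n≤n b a)) ⟩
    a + b / a * a                        ∎)

  corrected-ones-between : ∀ a b .{{_ : NonZero a}} → ¬ a ∣ b → Between a (corrected-ones a (suc b) zero)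
  corrected-ones-between a b a∤b = ∸-between (NP.n≢0⇒n>0 (λ r≡0 → a∤b (m%n≡0⇒n∣m b a r≡0)) , m%n<n b a)

  %-absorbˡ : ∀ p .{{_ : NonZero p}} x y → (x % p + y) % p ≡ (x + y) % p
  %-absorbˡ p x y = begin
    (x % p + y) % p            ≡⟨ %-distribˡ-+ (x % p) y p ⟩
    (x % p % p + y % p) % p    ≡⟨ cong (λ t → (t + y % p) % p) (m%n%n≡m%n x p) ⟩
    (x % p + y % p) % p        ≡⟨ sym (%-distribˡ-+ x y p) ⟩
    (x + y) % p                ∎

  module Rotation (p : ℕ) .{{_ : NonZero p}} where

    rotate : Fin p → Fin p → Fin p
    rotate r c = fromℕ< (m%n<n (toℕ r + toℕ c) p)

    rotate-comm : ∀ r c → rotate r c ≡ rotate c r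
    rotate-comm r c = FP.fromℕ<-cong _ _ (cong (_% p) (NP.+-comm (toℕ r) (toℕ c))) _ _

    unrotate : ∀ r c → (toℕ (rotate r c) + (p ∸ toℕ r)) % p ≡ toℕ c
    unrotate r c = begin
      (toℕ (rotate r c) + (p ∸ toℕ r)) % p
        ≡⟨ cong (λ t → (t + (p ∸ toℕ r)) % p) (FP.toℕ-fromℕ< (m%n<n (toℕ r + toℕ c) p)) ⟩
      ((toℕ r + toℕ c) % p + (p ∸ toℕ r)) % p    ≡⟨ %-absorbˡ p (toℕ r + toℕ c) (p ∸ toℕ r) ⟩
      (toℕ r + toℕ c + (p ∸ toℕ r)) % p          ≡⟨ cong (_% p) (shuffle (toℕ r) (toℕ c) (p ∸ toℕ r)) ⟩
      (toℕ c + (toℕ r + (p ∸ toℕ r))) % p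
        ≡⟨ cong (λ t → (toℕ c + t) % p) (NP.m+[n∸m]≡n (NP.<⇒≤ (FP.toℕ<n r))) ⟩
      (toℕ c + p) % p                            ≡⟨ [m+n]%n≡m%n (toℕ c) p ⟩
      toℕ c % p                                  ≡⟨ m<n⇒m%n≡m (FP.toℕ<n c) ⟩
      toℕ c                                      ∎
      where
        shuffle : ∀ r c d → r + c + d ≡ c + (r + d)
        shuffle = solve-∀

    rotate-injective : ∀ r → Injective _≡_ _≡_ (rotate r)
    rotate-injective r {c} {c′} eq = FP.toℕ-injective (begin
      toℕ c                                   ≡⟨ sym (unrotate r c) ⟩
      (toℕ (rotate r c) + (p ∸ toℕ r)) % p    ≡⟨ cong (λ x → (toℕ x + (p ∸ toℕ r)) % p) eq ⟩
      (toℕ (rotate r c′) + (p ∸ toℕ r)) % p   ≡⟨ unrotate r c′ ⟩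
      toℕ c′                                  ∎)

  wlog-≤ : ∀ {r} (R : ℕ → ℕ → Set r) → (∀ {u v} → R u v → R v u) →
           (∀ {u v} → u ≤ v → R u v → u ≡ v) → ∀ {u v} → R u v → u ≡ v
  wlog-≤ R R-sym ordered {u} {v} r with NP.≤-total u v
  ... | inj₁ u≤v = ordered u≤v r
  ... | inj₂ v≤u = sym (ordered v≤u (R-sym r))

  -- moving one unit of fuel into a further block of size k ≥ 1
  +-shift-≤ : ∀ m f {k} → 0 < k → m * k + suc f ≤ suc m * k + f
  +-shift-≤ m f {k} 0<k =
    NP.≤-trans (NP.≤-reflexive (NP.+-suc (m * k) f))
               (NP.≤-trans (NP.+-monoˡ-≤ (m * k + f) 0<k) (NP.≤-reflexive (sym (NP.+-assoc k (m * k) f))))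

open Arithmetic

module Multiples {c ℓ : Level} (G : AbelianGroup c ℓ) where
  open AbelianGroup G
  open import Algebra.Properties.CommutativeMonoid.Mult commutativeMonoid public
    using (×-congʳ; ×-congˡ; ×-homo-1; ×-homo-+; ×-assocˡ; ×-distrib-+) renaming (_×_ to _·_)
  open import Algebra.Properties.Group group
    using (inverseʳ-unique; identityʳ-unique; x∙y⁻¹≈ε⇒x≈y; x≈y⇒x∙y⁻¹≈ε; ⁻¹-involutive; ∙-cancelˡ; ∙-cancelʳ; y≈x\\z)
  open import Algebra.Properties.CommutativeSemigroup commutativeSemigroup using (x∙yz≈xz∙y; interchange)
  open import Algebra.Properties.AbelianGroup G using (⁻¹-∙-comm)
  open import Relation.Binary.Reasoning.Setoid setoid

  ·-ε : ∀ k → k · ε ≈ ε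
  ·-ε zero    = refl
  ·-ε (suc k) = trans (identityˡ _) (·-ε k)

  ·-assoc : ∀ m k x → (m * k) · x ≈ m · (k · x)
  ·-assoc m k x = sym (×-assocˡ x m k)

  ·-comm : ∀ m k x → m · (k · x) ≈ k · (m · x)
  ·-comm m k x = trans (sym (·-assoc m k x)) (trans (×-congˡ (NP.*-comm m k)) (·-assoc k m x))

  ·-killed : ∀ {m k x} → m ∣ k → m · x ≈ ε → k · x ≈ ε
  ·-killed {m} {k} {x} (divides q ≡.refl) mx≈ε = begin
    (q * m) · x   ≈⟨ ·-assoc q m x ⟩
    q · (m · x)   ≈⟨ ×-congʳ q mx≈ε ⟩
    q · ε         ≈⟨ ·-ε q ⟩
    ε             ∎

  ·-mod : ∀ {p x} .{{_ : NonZero p}} → p · x ≈ ε → ∀ k → k · x ≈ (k % p) · x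
  ·-mod {p} {x} px≈ε k = begin
    k · x                               ≈⟨ ×-congˡ (m≡m%n+[m/n]*n k p) ⟩
    (k % p + k / p * p) · x             ≈⟨ ×-homo-+ x (k % p) (k / p * p) ⟩
    (k % p) · x ∙ (k / p * p) · x       ≈⟨ ∙-congˡ (·-killed (divides (k / p) ≡.refl) px≈ε) ⟩
    (k % p) · x ∙ ε                     ≈⟨ identityʳ _ ⟩
    (k % p) · x                         ∎

  ·-fin : ∀ {p x} .{{_ : NonZero p}} → p · x ≈ ε → ∀ k → toℕ (fromℕ< (m%n<n k p)) · x ≈ k · x
  ·-fin {p} px≈ε k = trans (×-congˡ (FP.toℕ-fromℕ< (m%n<n k p))) (sym (·-mod px≈ε k))

  ·-⁻¹ : ∀ k x → k · (x ⁻¹) ≈ (k · x) ⁻¹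
  ·-⁻¹ k x = inverseʳ-unique (k · x) (k · (x ⁻¹)) (begin
    k · x ∙ k · (x ⁻¹)   ≈⟨ sym (×-distrib-+ x (x ⁻¹) k) ⟩
    k · (x ∙ x ⁻¹)       ≈⟨ ×-congʳ k (inverseʳ x) ⟩
    k · ε                ≈⟨ ·-ε k ⟩
    ε                    ∎)

  inverse-multiple : ∀ {p x} .{{_ : NonZero p}} → p · x ≈ ε → x ⁻¹ ≈ (p ∸ 1) · x
  inverse-multiple {p} {x} px≈ε = sym (inverseʳ-unique x ((p ∸ 1) · x) (begin
    x ∙ (p ∸ 1) · x     ≈⟨ ∙-congʳ (sym (×-homo-1 x)) ⟩
    1 · x ∙ (p ∸ 1) · x ≈⟨ sym (×-homo-+ x 1 (p ∸ 1)) ⟩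
    (1 + (p ∸ 1)) · x   ≈⟨ ×-congˡ (NP.m+[n∸m]≡n (ℕ.>-nonZero⁻¹ p)) ⟩
    p · x               ≈⟨ px≈ε ⟩
    ε                   ∎))

  killed-multiple : ∀ {x} m k → m · x ≈ ε → m · (k · x) ≈ ε
  killed-multiple {x} m k mx≈ε = trans (·-comm m k x) (trans (×-congʳ k mx≈ε) (·-ε k))

  ·-difference : ∀ k x y → k · (x ∙ y ⁻¹) ≈ k · x ∙ (k · y) ⁻¹
  ·-difference k x y = trans (×-distrib-+ x (y ⁻¹) k) (∙-congˡ (·-⁻¹ k y))

  _∈⟨_⟩ : Carrier → Carrier → Set ℓ
  x ∈⟨ g ⟩ = ∃ λ t → t · g ≈ x

  ∈⟨⟩-resp : ∀ {g x y} → x ≈ y → x ∈⟨ g ⟩ → y ∈⟨ g ⟩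
  ∈⟨⟩-resp x≈y (t , tg≈x) = t , trans tg≈x x≈y

  ∈⟨⟩-∙ : ∀ {g x y} → x ∈⟨ g ⟩ → y ∈⟨ g ⟩ → (x ∙ y) ∈⟨ g ⟩
  ∈⟨⟩-∙ {g} (t , tg≈x) (s , sg≈y) = t + s , trans (×-homo-+ g t s) (∙-cong tg≈x sg≈y)

  ∈⟨⟩-· : ∀ {g x} k → x ∈⟨ g ⟩ → (k · x) ∈⟨ g ⟩
  ∈⟨⟩-· {g} k (t , tg≈x) = k * t , trans (·-assoc k t g) (×-congʳ k tg≈x)

  ∈⟨⟩-⁻¹ : ∀ {p g x} .{{_ : NonZero p}} → p · g ≈ ε → x ∈⟨ g ⟩ → (x ⁻¹) ∈⟨ g ⟩
  ∈⟨⟩-⁻¹ {p} {g} {x} pg≈ε (t , tg≈x) = ∈⟨⟩-resp (begin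
    t · ((p ∸ 1) · g)   ≈⟨ ×-congʳ t (sym (inverse-multiple pg≈ε)) ⟩
    t · (g ⁻¹)          ≈⟨ ·-⁻¹ t g ⟩
    (t · g) ⁻¹          ≈⟨ ⁻¹-cong tg≈x ⟩
    x ⁻¹                ∎) (∈⟨⟩-· t (p ∸ 1 , refl))

  coprime-root : ∀ {p d g x} .{{_ : NonZero p}} → Coprime p d → p · g ≈ ε → p · x ≈ ε →
                 (d · x) ∈⟨ g ⟩ → x ∈⟨ g ⟩
  coprime-root {p} {d} {g} {x} coprime pg≈ε px≈ε dx∈⟨g⟩ with coprime-Bézout coprime
  ... | Bézout.-+ u v 1+up≡vd = ∈⟨⟩-resp (begin
    v · (d · x)         ≈⟨ sym (·-assoc v d x) ⟩
    (v * d) · x         ≈⟨ ×-congˡ (≡.sym 1+up≡vd) ⟩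
    x ∙ (u * p) · x     ≈⟨ ∙-congˡ (·-killed (divides u ≡.refl) px≈ε) ⟩
    x ∙ ε               ≈⟨ identityʳ x ⟩
    x                   ∎) (∈⟨⟩-· v dx∈⟨g⟩)
  ... | Bézout.+- u v 1+vd≡up =
    ∈⟨⟩-resp (⁻¹-involutive x) (∈⟨⟩-⁻¹ pg≈ε (∈⟨⟩-resp v·dx≈x⁻¹ (∈⟨⟩-· v dx∈⟨g⟩)))
    where
      v·dx≈x⁻¹ : v · (d · x) ≈ x ⁻¹
      v·dx≈x⁻¹ = inverseʳ-unique x (v · (d · x)) (begin
        x ∙ v · (d · x)     ≈⟨ ∙-congˡ (sym (·-assoc v d x)) ⟩
        x ∙ (v * d) · x     ≈⟨ ×-congˡ 1+vd≡up ⟩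
        (u * p) · x         ≈⟨ ·-killed (divides u ≡.refl) px≈ε ⟩
        ε                   ∎)

  coprime-kill : ∀ {p d x} .{{_ : NonZero p}} → Coprime p d → p · x ≈ ε → d · x ≈ ε → x ≈ ε
  coprime-kill {p} {d} {x} coprime px≈ε dx≈ε with coprime-root coprime (·-ε p) px≈ε (0 , sym dx≈ε)
  ... | t , tε≈x = trans (sym tε≈x) (·-ε t)

  coprime-cancel : ∀ {p k x y} .{{_ : NonZero p}} → Coprime p k → p · x ≈ ε → p · y ≈ ε →
                   k · x ≈ k · y → x ≈ y
  coprime-cancel {p} {k} {x} {y} coprime px≈ε py≈ε kx≈ky = x∙y⁻¹≈ε⇒x≈y x y
    (coprime-kill coprime (trans (·-difference p x y) (x≈y⇒x∙y⁻¹≈ε (trans px≈ε (sym py≈ε))))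
                          (trans (·-difference k x y) (x≈y⇒x∙y⁻¹≈ε kx≈ky)))

  multiples-distinct : ∀ {p g} → Prime p → p · g ≈ ε → ¬ g ≈ ε →
                       ∀ {u v} → u < p → v < p → u · g ≈ v · g → u ≡ v
  multiples-distinct {p} {g} p-prime pg≈ε g≉ε u<p v<p ug≈vg =
    wlog-≤ R (λ (u<p , v<p , eq) → v<p , u<p , sym eq) ordered (u<p , v<p , ug≈vg)
    where
      instance _ = prime⇒nonZero p-prime
      R : ℕ → ℕ → Set ℓ
      R u v = u < p × v < p × u · g ≈ v · g
      ordered : ∀ {u v} → u ≤ v → R u v → u ≡ v
      ordered {u} u≤v (_ , v<p , ug≈vg) with NP.m≤n⇒∃[o]m+o≡n u≤v
      ... | zero  , ≡.refl = ≡.sym (NP.+-identityʳ u)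
      ... | suc d , ≡.refl = ⊥-elim (g≉ε (coprime-kill (unit⇒coprime p-prime (s≤s z≤n , d<p)) pg≈ε dg≈ε))
        where
          d<p : suc d < p
          d<p = NP.≤-<-trans (NP.m≤n+m (suc d) u) v<p
          dg≈ε : suc d · g ≈ ε
          dg≈ε = identityʳ-unique (u · g) (suc d · g) (trans (sym (×-homo-+ g u (suc d))) (sym ug≈vg))

  scaled-distinct : ∀ {p g k} → Prime p → p · g ≈ ε → ¬ g ≈ ε → Coprime p k →
                    ∀ {u v} → u < p → v < p → (u * k) · g ≈ (v * k) · g → u ≡ v
  scaled-distinct {p} {g} {k} p-prime pg≈ε g≉ε coprime {u} {v} u<p v<p eq =
    multiples-distinct p-prime pg≈ε g≉ε u<p v<p
      (coprime-cancel coprime (killed-multiple p u pg≈ε) (killed-multiple p v pg≈ε)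
        (trans (sym (scale u)) (trans eq (scale v))))
    where
      instance _ = prime⇒nonZero p-prime
      scale : ∀ u → (u * k) · g ≈ k · (u · g)
      scale u = trans (×-congˡ (NP.*-comm u k)) (·-assoc k u g)

  components : ∀ {a b g h u v u′ v′} .{{_ : NonZero a}} → Coprime a b → a · g ≈ ε → b · h ≈ ε →
               u · g ∙ v · h ≈ u′ · g ∙ v′ · h → u · g ≈ u′ · g × v · h ≈ v′ · h
  components {a} {b} {g} {h} {u} {v} {u′} {v′} coprime ag≈ε bh≈ε eq = g-parts , h-parts
    where
      times-b : ∀ u v → b · (u · g ∙ v · h) ≈ b · (u · g)
      times-b u v = trans (×-distrib-+ (u · g) (v · h) b) (trans (∙-congˡ (killed-multiple b v bh≈ε)) (identityʳ _))
      g-parts : u · g ≈ u′ · g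
      g-parts = coprime-cancel coprime (killed-multiple a u ag≈ε) (killed-multiple a u′ ag≈ε)
                  (trans (sym (times-b u v)) (trans (×-congʳ b eq) (times-b u′ v′)))
      h-parts : v · h ≈ v′ · h
      h-parts = ∙-cancelˡ (u · g) (v · h) (v′ · h) (trans eq (∙-congʳ (sym g-parts)))

  Coordinates : ℕ → ℕ → Carrier → Carrier → Set ℓ
  Coordinates p q g h = ∀ {u v u′ v′} → u < p → v < q → u′ < p → v′ < q →
                        u · g ∙ v · h ≈ u′ · g ∙ v′ · h → u ≡ u′ × v ≡ v′

  cyclic-coordinates : ∀ {p y} → Prime p → (p * p) · y ≈ ε → ¬ p · y ≈ ε → Coordinates p p (p · y) y
  cyclic-coordinates {p} {y} p-prime ppy≈ε py≉ε {u} {v} {u′} {v′} u<p v<p u′<p v′<p eq =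
    u≡u′ , v≡v′
    where
      g : Carrier
      g = p · y
      pg≈ε : p · g ≈ ε
      pg≈ε = trans (sym (·-assoc p p y)) ppy≈ε
      times-p : ∀ u v → p · (u · g ∙ v · y) ≈ v · g
      times-p u v = begin
        p · (u · g ∙ v · y)        ≈⟨ ×-distrib-+ (u · g) (v · y) p ⟩
        p · (u · g) ∙ p · (v · y)  ≈⟨ ∙-cong (killed-multiple p u pg≈ε) (·-comm p v y) ⟩
        ε ∙ v · g                  ≈⟨ identityˡ _ ⟩
        v · g                      ∎
      v≡v′ : v ≡ v′
      v≡v′ = multiples-distinct p-prime pg≈ε py≉ε v<p v′<p
               (trans (sym (times-p u v)) (trans (×-congʳ p eq) (times-p u′ v′)))
      u≡u′ : u ≡ u′
      u≡u′ = multiples-distinct p-prime pg≈ε py≉ε u<p u′<p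
               (∙-cancelʳ (v · y) (u · g) (u′ · g) (trans eq (∙-congˡ (×-congˡ (≡.sym v≡v′)))))

  independent-coordinates : ∀ {p g h} → Prime p → p · g ≈ ε → p · h ≈ ε → ¬ g ≈ ε → ¬ h ∈⟨ g ⟩ →
                            Coordinates p p g h
  independent-coordinates {p} {g} {h} p-prime pg≈ε ph≈ε g≉ε h∉⟨g⟩ {u} {v} {u′} {v′} u<p v<p u′<p v′<p eq =
    u≡u′ , v≡v′
    where
      instance _ = prime⇒nonZero p-prime
      R : ℕ → ℕ → Set ℓ
      R v v′ = v < p × v′ < p × ∃ λ u → ∃ λ u′ → u · g ∙ v · h ≈ u′ · g ∙ v′ · h
      ordered : ∀ {v v′} → v ≤ v′ → R v v′ → v ≡ v′
      ordered {v} v≤v′ (_ , v′<p , u , u′ , eq) with NP.m≤n⇒∃[o]m+o≡n v≤v′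
      ... | zero  , ≡.refl = ≡.sym (NP.+-identityʳ v)
      ... | suc d , ≡.refl =
        ⊥-elim (h∉⟨g⟩ (coprime-root (unit⇒coprime p-prime (s≤s z≤n , d<p)) pg≈ε ph≈ε dh∈⟨g⟩))
        where
          d<p : suc d < p
          d<p = NP.≤-<-trans (NP.m≤n+m (suc d) v) v′<p
          shifted : u′ · g ∙ suc d · h ≈ u · g
          shifted = sym (∙-cancelʳ (v · h) (u · g) (u′ · g ∙ suc d · h) (begin
            u · g ∙ v · h                   ≈⟨ eq ⟩
            u′ · g ∙ (v + suc d) · h        ≈⟨ ∙-congˡ (×-homo-+ h v (suc d)) ⟩
            u′ · g ∙ (v · h ∙ suc d · h)    ≈⟨ x∙yz≈xz∙y (u′ · g) (v · h) (suc d · h) ⟩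
            (u′ · g ∙ suc d · h) ∙ v · h    ∎))
          dh∈⟨g⟩ : (suc d · h) ∈⟨ g ⟩
          dh∈⟨g⟩ = ∈⟨⟩-resp (sym (y≈x\\z (u′ · g) (suc d · h) (u · g) shifted))
                           (∈⟨⟩-∙ (∈⟨⟩-⁻¹ pg≈ε (u′ , refl)) (u , refl))
      v≡v′ : v ≡ v′
      v≡v′ = wlog-≤ R (λ (v<p , v′<p , u , u′ , eq) → v′<p , v<p , u′ , u , sym eq) ordered
                     (v<p , v′<p , u , u′ , eq)
      u≡u′ : u ≡ u′
      u≡u′ = multiples-distinct p-prime pg≈ε g≉ε u<p u′<p
               (∙-cancelʳ (v · h) (u · g) (u′ · g) (trans eq (∙-congˡ (×-congˡ (≡.sym v≡v′)))))

  PairInjective : ∀ {a b} → (Fin a → Fin b → Carrier) → Set ℓ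
  PairInjective E = ∀ {i j i′ j′} → E i j ≈ E i′ j′ → i ≡ i′ × j ≡ j′

  flatten : ∀ {a b} → (Fin a → Fin b → Carrier) → Fin (a * b) → Carrier
  flatten {a} {b} E q = E (proj₁ (remQuot {a} b q)) (proj₂ (remQuot {a} b q))

  flatten-injective : ∀ {a b} (E : Fin a → Fin b → Carrier) → PairInjective E → Injective _≡_ _≈_ (flatten E)
  flatten-injective {a} {b} E E-injective {q} {q′} eq with E-injective eq
  ... | i≡i′ , j≡j′ =
    ≡.trans (≡.sym (FP.combine-remQuot {a} b q)) (≡.trans (≡.cong₂ combine i≡i′ j≡j′) (FP.combine-remQuot {a} b q′))

  flatten-combine : ∀ {a b} (E : Fin a → Fin b → Carrier) i j → flatten E (combine i j) ≈ E i j
  flatten-combine {a} {b} E i j = reflexive (≡.cong (λ (i , j) → E i j) (FP.remQuot-combine {a} {b} i j))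

  coordinates-injective : ∀ {p q g h} → Coordinates p q g h →
                          PairInjective (λ (u : Fin p) (v : Fin q) → toℕ u · g ∙ toℕ v · h)
  coordinates-injective coordinates {u} {v} {u′} {v′} eq
    with coordinates (FP.toℕ<n u) (FP.toℕ<n v) (FP.toℕ<n u′) (FP.toℕ<n v′) eq
  ... | u≡u′ , v≡v′ = FP.toℕ-injective u≡u′ , FP.toℕ-injective v≡v′

  combination-difference : ∀ {p g h} .{{_ : NonZero p}} → p · g ≈ ε → p · h ≈ ε → ∀ u v u′ v′ →
                           ∃ λ s → ∃ λ s′ → s · g ∙ s′ · h ≈ (u · g ∙ v · h) ∙ (u′ · g ∙ v′ · h) ⁻¹
  combination-difference {g = g} {h} pg≈ε ph≈ε u v u′ v′
    with ∈⟨⟩-∙ (u , refl) (∈⟨⟩-⁻¹ pg≈ε (u′ , refl)) | ∈⟨⟩-∙ (v , refl) (∈⟨⟩-⁻¹ ph≈ε (v′ , refl))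
  ... | s , sg≈ | s′ , s′h≈ = s , s′ , (begin
    s · g ∙ s′ · h                                    ≈⟨ ∙-cong sg≈ s′h≈ ⟩
    (u · g ∙ (u′ · g) ⁻¹) ∙ (v · h ∙ (v′ · h) ⁻¹)     ≈⟨ interchange _ _ _ _ ⟩
    (u · g ∙ v · h) ∙ ((u′ · g) ⁻¹ ∙ (v′ · h) ⁻¹)     ≈⟨ ∙-congˡ (⁻¹-∙-comm _ _) ⟩
    (u · g ∙ v · h) ∙ (u′ · g ∙ v′ · h) ⁻¹            ∎)

module FiniteGroup {c ℓ : Level} (G : AbelianGroup c ℓ) {n : ℕ} (order : HasOrder G n) where
  open AbelianGroup G
  open Multiples G
  open import Algebra.Properties.CommutativeMonoid.Sum commutativeMonoid
    using (sum; sum-permute; ∑-distrib-+; sum-replicate; sum-cong-≋)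
  open import Algebra.Properties.Group group using (identityˡ-unique; ∙-cancelˡ; //-rightDividesʳ)
  open import Relation.Binary.Reasoning.Setoid setoid

  enum : Fin n → Carrier
  enum = Bijection.to order

  enum-injective : Injective _≡_ _≈_ enum
  enum-injective = Bijection.injective order

  index : Carrier → Fin n
  index x = proj₁ (Bijection.strictlySurjective order x)

  enum-index : ∀ x → enum (index x) ≈ x
  enum-index x = proj₂ (Bijection.strictlySurjective order x)

  index-injective : ∀ {x y} → index x ≡ index y → x ≈ y
  index-injective {x} {y} eq = trans (sym (enum-index x)) (trans (reflexive (≡.cong enum eq)) (enum-index y))

  _≈?_ : Decidable _≈_
  x ≈? y = map′ index-injective (λ x≈y → enum-injective (trans (enum-index x) (trans x≈y (sym (enum-index y)))))
                (index x FP.≟ index y)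

  -- translating by x permutes Γ, so Σ y = Σ (x + y) = n·x + Σ y and hence n·x = ε
  exponent : ∀ x → n · x ≈ ε
  exponent x = identityˡ-unique (n · x) (sum enum) (sym (begin
    sum enum                      ≈⟨ sum-permute enum translation ⟩
    sum (λ i → enum (shift x i))  ≈⟨ sum-cong-≋ (λ i → enum-index (x ∙ enum i)) ⟩
    sum (λ i → x ∙ enum i)        ≈⟨ ∑-distrib-+ (λ _ → x) enum ⟩
    sum {n} (λ _ → x) ∙ sum enum  ≈⟨ ∙-congʳ (sum-replicate n) ⟩
    n · x ∙ sum enum              ∎))
    where
      shift : Carrier → Fin n → Fin n
      shift y i = index (y ∙ enum i)
      shift-shift : ∀ y z i → shift y (shift z i) ≡ shift (y ∙ z) i
      shift-shift y z i = enum-injective (trans (enum-index _) (trans (∙-congˡ (enum-index _))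
                            (trans (sym (assoc y z (enum i))) (sym (enum-index _)))))
      shift-cancel : ∀ {y z} → y ∙ z ≈ ε → ∀ i → shift y (shift z i) ≡ i
      shift-cancel {y} {z} yz≈ε i = ≡.trans (shift-shift y z i) (enum-injective (trans (enum-index _)
                                      (trans (∙-congʳ yz≈ε) (identityˡ (enum i)))))
      translation : Permutation n n
      translation = permutation (shift x) (shift (x ⁻¹)) (shift-cancel (inverseʳ x)) (shift-cancel (inverseˡ x))

  all-or-counterexample : ∀ {p} {P : Carrier → Set p} → (∀ x → Dec (P x)) → (∀ {x y} → x ≈ y → P x → P y) →
                          (∀ x → P x) ⊎ ∃ λ x → ¬ P x
  all-or-counterexample {P = P} P? P-resp with FP.all? (λ i → P? (enum i))
  ... | yes everywhere = inj₁ (λ x → P-resp (enum-index x) (everywhere (index x)))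
  ... | no  ¬everywhere with FP.¬∀⟶∃¬ n (λ i → P (enum i)) (λ i → P? (enum i)) ¬everywhere
  ...   | i , ¬Pi = inj₂ (enum i , ¬Pi)

  injection-bound : ∀ {m} (f : Fin m → Carrier) → Injective _≡_ _≈_ f → m ≤ n
  injection-bound f f-injective = FP.injective⇒≤ {f = index ∘ f} (λ eq → f-injective (index-injective eq))

  surjection-bound : ∀ {m} (f : Fin m → Carrier) → (∀ y → ∃ λ i → f i ≈ y) → n ≤ m
  surjection-bound f onto = FP.injective⇒≤ {f = λ x → proj₁ (onto (enum x))} (λ {x} {y} eq → enum-injective (begin
    enum x                    ≈⟨ sym (proj₂ (onto (enum x))) ⟩
    f (proj₁ (onto (enum x))) ≈⟨ reflexive (≡.cong f eq) ⟩
    f (proj₁ (onto (enum y))) ≈⟨ proj₂ (onto (enum y)) ⟩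
    enum y                    ∎))

  onto-or-miss : ∀ {m} (f : Fin m → Carrier) → (∀ y → ∃ λ i → f i ≈ y) ⊎ ∃ λ y → ∀ i → ¬ f i ≈ y
  onto-or-miss f
    with all-or-counterexample (λ y → FP.any? (λ i → f i ≈? y)) (λ x≈y (i , fi≈x) → i , trans fi≈x x≈y)
  ... | inj₁ onto         = inj₁ onto
  ... | inj₂ (y , missed) = inj₂ (y , λ i fi≈y → missed (i , fi≈y))

  misses : ∀ {m} → m < n → (f : Fin m → Carrier) → ∃ λ y → ∀ i → ¬ f i ≈ y
  misses m<n f with onto-or-miss f
  ... | inj₁ onto = ⊥-elim (NP.<⇒≱ m<n (surjection-bound f onto))
  ... | inj₂ miss = miss

  injection-onto : (f : Fin n → Carrier) → Injective _≡_ _≈_ f → ∀ y → ∃ λ i → f i ≈ y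
  injection-onto f f-injective y with fin-injective⇒surjective (index ∘ f) (λ eq → f-injective (index-injective eq)) (index y)
  ... | i , eq = i , index-injective eq

  nontrivial-element : 1 < n → ∃ λ g → ¬ g ≈ ε
  nontrivial-element 1<n with misses 1<n (λ _ → ε)
  ... | g , missed = g , λ g≈ε → missed Fin.zero (sym g≈ε)

  outside : ∀ {p g} .{{_ : NonZero p}} → p < n → p · g ≈ ε → ∃ λ h → ¬ h ∈⟨ g ⟩
  outside {p} {g} p<n pg≈ε with misses p<n (λ i → toℕ i · g)
  ... | h , missed = h , λ (t , tg≈h) → missed (fromℕ< (m%n<n t p)) (trans (·-fin pg≈ε t) tg≈h)

  -- Lagrange: the size k of a subgroup H, listed without repetition by φ, divides n
  module Lagrange {k} (φ : Fin k → Carrier) (φ-injective : Injective _≡_ _≈_ φ)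
                  (φ-closed : ∀ i j → ∃ λ l → φ l ≈ φ i ∙ φ j ⁻¹) (0<k : 0 < k) where

    -- t lists representatives of pairwise disjoint cosets t i + H
    Disjoint : ∀ {m} → (Fin m → Carrier) → Set ℓ
    Disjoint t = PairInjective (λ i j → t i ∙ φ j)

    cosets : ∀ {m} → (Fin m → Carrier) → Fin (m * k) → Carrier
    cosets t = flatten (λ i j → t i ∙ φ j)

    same-coset : ∀ {y z j j′} → y ∙ φ j ≈ z ∙ φ j′ → ∃ λ l → z ∙ φ l ≈ y
    same-coset {y} {z} {j} {j′} eq with φ-closed j′ j
    ... | l , φl≈ = l , (begin
      z ∙ φ l                  ≈⟨ ∙-congˡ φl≈ ⟩
      z ∙ (φ j′ ∙ φ j ⁻¹)      ≈⟨ sym (assoc z (φ j′) (φ j ⁻¹)) ⟩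
      (z ∙ φ j′) ∙ φ j ⁻¹      ≈⟨ ∙-congʳ (sym eq) ⟩
      (y ∙ φ j) ∙ φ j ⁻¹       ≈⟨ //-rightDividesʳ (φ j) y ⟩
      y                        ∎)

    adjoin : ∀ {m} (t : Fin m → Carrier) y → Disjoint t → (∀ q → ¬ cosets t q ≈ y) → Disjoint (y ∷ t)
    adjoin t y disjoint fresh {Fin.zero} {j} {Fin.zero} {j′} eq = ≡.refl , φ-injective (∙-cancelˡ y (φ j) (φ j′) eq)
    adjoin t y disjoint fresh {Fin.zero} {_} {Fin.suc i′} eq with same-coset eq
    ... | l , in-coset = ⊥-elim (fresh (combine i′ l) (trans (flatten-combine (λ i j → t i ∙ φ j) i′ l) in-coset))
    adjoin t y disjoint fresh {Fin.suc i} {_} {Fin.zero} eq with same-coset (sym eq)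
    ... | l , in-coset = ⊥-elim (fresh (combine i l) (trans (flatten-combine (λ i j → t i ∙ φ j) i l) in-coset))
    adjoin t y disjoint fresh {Fin.suc i} {_} {Fin.suc i′} eq with disjoint eq
    ... | ≡.refl , j≡j′ = ≡.refl , j≡j′

    -- keep adjoining cosets until Γ is covered; fuel bounds the number of steps
    cover : ∀ fuel {m} (t : Fin m → Carrier) → Disjoint t → n ≤ m * k + fuel → k ∣ n
    cover zero {m} t disjoint n≤mk+0 =
      divides m (NP.≤-antisym (≡.subst (n ≤_) (NP.+-identityʳ (m * k)) n≤mk+0)
                              (injection-bound (cosets t) (flatten-injective _ disjoint)))
    cover (suc fuel) {m} t disjoint n≤mk+1+fuel with onto-or-miss (cosets t)
    ... | inj₁ onto =
      divides m (NP.≤-antisym (surjection-bound (cosets t) onto) (injection-bound (cosets t) (flatten-injective _ disjoint)))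
    ... | inj₂ (y , fresh) = cover fuel (y ∷ t) (adjoin t y disjoint fresh) (NP.≤-trans n≤mk+1+fuel (+-shift-≤ m fuel 0<k))

    lagrange : k ∣ n
    lagrange = cover n {0} (λ ()) (λ { {()} }) NP.≤-refl

  independent-pair : ∀ {p} → Prime p → (∀ x → p · x ≈ ε) → p < n → ∃ λ g → ∃ λ h → Coordinates p p g h
  independent-pair {p} p-prime exponent-p p<n with nontrivial-element (NP.<-trans (prime>1 p-prime) p<n)
  ... | g , g≉ε with outside {{prime⇒nonZero p-prime}} p<n (exponent-p g)
  ...   | h , h∉⟨g⟩ = g , h , independent-coordinates p-prime (exponent-p g) (exponent-p h) g≉ε h∉⟨g⟩

  -- such a group has order divisible by p²: the p² combinations u·g + v·h form a subgroup
  exponent-square : ∀ {p} → Prime p → (∀ x → p · x ≈ ε) → p < n → p * p ∣ n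
  exponent-square {p} p-prime exponent-p p<n =
    Lagrange.lagrange span span-injective span-closed (ℕ.>-nonZero⁻¹ (p * p) {{NP.m*n≢0 p p}})
    where
      instance _ = prime⇒nonZero p-prime
      pair : ∃ λ g → ∃ λ h → Coordinates p p g h
      pair = independent-pair p-prime exponent-p p<n
      g h : Carrier
      g = proj₁ pair
      h = proj₁ (proj₂ pair)
      combinations : Fin p → Fin p → Carrier
      combinations u v = toℕ u · g ∙ toℕ v · h
      span : Fin (p * p) → Carrier
      span = flatten combinations
      span-injective : Injective _≡_ _≈_ span
      span-injective = flatten-injective combinations (coordinates-injective (proj₂ (proj₂ pair)))
      listed : ∀ s s′ → ∃ λ l → span l ≈ s · g ∙ s′ · h
      listed s s′ = combine u v , trans (flatten-combine combinations u v)
                                        (∙-cong (·-fin (exponent-p g) s) (·-fin (exponent-p h) s′))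
        where
          u v : Fin p
          u = fromℕ< (m%n<n s p)
          v = fromℕ< (m%n<n s′ p)
      span-closed : ∀ i j → ∃ λ l → span l ≈ span i ∙ span j ⁻¹
      span-closed i j = proj₁ found , trans (proj₂ found) (proj₂ (proj₂ difference))
        where
          coefficients : Fin (p * p) → Fin p × Fin p
          coefficients = remQuot {p} p
          difference : ∃ λ s → ∃ λ s′ → s · g ∙ s′ · h ≈ span i ∙ span j ⁻¹
          difference = combination-difference (exponent-p g) (exponent-p h)
                         (toℕ (proj₁ (coefficients i))) (toℕ (proj₂ (coefficients i)))
                         (toℕ (proj₁ (coefficients j))) (toℕ (proj₂ (coefficients j)))
          found : ∃ λ l → span l ≈ proj₁ difference · g ∙ proj₁ (proj₂ difference) · h
          found = listed (proj₁ difference) (proj₁ (proj₂ difference))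

  element-of-order : ∀ {a b} → Prime a → Prime b → a ≢ b → n ≡ a * b → ∃ λ g → a · g ≈ ε × ¬ g ≈ ε
  element-of-order {a} {b} a-prime b-prime a≢b n≡ab
    with all-or-counterexample (λ x → (b · x) ≈? ε) (λ x≈y bx≈ε → trans (×-congʳ b (sym x≈y)) bx≈ε)
  ... | inj₂ (y , by≉ε) = b · y , trans (sym (·-assoc a b y)) (trans (×-congˡ (≡.sym n≡ab)) (exponent y)) , by≉ε
  ... | inj₁ exponent-b = ⊥-elim (a≢b (≡.sym (prime-divisor b-prime a-prime b∣a)))
    where
      instance _ = prime⇒nonZero b-prime
      b<n : b < n
      b<n = ≡.subst (b <_) (≡.trans (NP.*-comm b a) (≡.sym n≡ab)) (NP.m<m*n b a (prime>1 a-prime))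
      b∣a : b ∣ a
      b∣a = *-cancelʳ-∣ b (≡.subst (b * b ∣_) n≡ab (exponent-square b-prime exponent-b b<n))

  square-coordinates : ∀ {p} → Prime p → n ≡ p * p → ∃ λ g → ∃ λ h → p · g ≈ ε × Coordinates p p g h
  square-coordinates {p} p-prime n≡pp
    with all-or-counterexample (λ x → (p · x) ≈? ε) (λ x≈y px≈ε → trans (×-congʳ p (sym x≈y)) px≈ε)
  ... | inj₂ (y , py≉ε) = p · y , y , trans (sym (·-assoc p p y)) ppy≈ε , cyclic-coordinates p-prime ppy≈ε py≉ε
    where
      ppy≈ε : (p * p) · y ≈ ε
      ppy≈ε = trans (×-congˡ (≡.sym n≡pp)) (exponent y)
  ... | inj₁ exponent-p = g , h , exponent-p g , coordinates
    where
      p<n : p < n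
      p<n = ≡.subst (p <_) (≡.sym n≡pp) (NP.m<m*n p p {{prime⇒nonZero p-prime}} (prime>1 p-prime))
      pair : ∃ λ g → ∃ λ h → Coordinates p p g h
      pair = independent-pair p-prime exponent-p p<n
      g h : Carrier
      g = proj₁ pair
      h = proj₁ (proj₂ pair)
      coordinates : Coordinates p p g h
      coordinates = proj₂ (proj₂ pair)

module MagicRectangles {c ℓ : Level} (G : AbelianGroup c ℓ) where
  open AbelianGroup G
  open Multiples G
  open import Algebra.Properties.CommutativeMonoid.Sum commutativeMonoid using (∑-distrib-+)
  open import Relation.Binary.Reasoning.Setoid setoid

  transpose : ∀ {a b} → MagicRectangle G b a → MagicRectangle G a b
  transpose {a} {b} M = record
    { entry      = λ i j → entry j i
    ; bijective  = (λ eq → ≡.cong swap (proj₁ bijective eq))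
                 , (λ y → swap (proj₁ (proj₂ bijective y)) , λ { ≡.refl → proj₂ (proj₂ bijective y) ≡.refl })
    ; ω          = δ
    ; δ          = ω
    ; rowSums    = columnSums
    ; columnSums = rowSums
    }
    where
      open MagicRectangle M
      swap : ∀ {A B : Set} → A × B → B × A
      swap (x , y) = y , x

  array-bijective : ∀ {a b} → HasOrder G (a * b) → (E : Fin a → Fin b → Carrier) → PairInjective E →
                    Bijective _≡_ _≈_ (λ (q : Fin a × Fin b) → E (proj₁ q) (proj₂ q))
  array-bijective {a} {b} order E E-injective =
    (λ eq → ≡.cong₂ _,_ (proj₁ (E-injective eq)) (proj₂ (E-injective eq))) , onto
    where
      open FiniteGroup G order using (injection-onto)
      onto : Surjective _≡_ _≈_ (λ (q : Fin a × Fin b) → E (proj₁ q) (proj₂ q))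
      onto y with injection-onto (flatten E) (flatten-injective E E-injective) y
      ... | q , Eq≈y = remQuot {a} b q , λ { ≡.refl → Eq≈y }

  sum-multiples : ∀ {k} (f : Fin k → ℕ) g → gsum G (λ i → f i · g) ≈ Σℕ f · g
  sum-multiples {zero}  f g = refl
  sum-multiples {suc k} f g = trans (∙-congˡ (sum-multiples (f ∘ Fin.suc) g)) (sym (×-homo-+ g (f Fin.zero) _))

  sum-combination : ∀ {k} g h (I J : Fin k → ℕ) → gsum G (λ i → I i · g ∙ J i · h) ≈ Σℕ I · g ∙ Σℕ J · h
  sum-combination g h I J =
    trans (∑-distrib-+ (λ i → I i · g) (λ i → J i · h)) (∙-cong (sum-multiples I g) (sum-multiples J h))

  vanishing-sum : ∀ {k a b g h} (I J : Fin k → ℕ) → a · g ≈ ε → b · h ≈ ε → a ∣ Σℕ I → b ∣ Σℕ J →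
                  gsum G (λ i → I i · g ∙ J i · h) ≈ ε
  vanishing-sum {g = g} {h} I J ag≈ε bh≈ε a∣ΣI b∣ΣJ = begin
    gsum G (λ i → I i · g ∙ J i · h)   ≈⟨ sum-combination g h I J ⟩
    Σℕ I · g ∙ Σℕ J · h               ≈⟨ ∙-cong (·-killed a∣ΣI ag≈ε) (·-killed b∣ΣJ bh≈ε) ⟩
    ε ∙ ε                             ≈⟨ identityʳ ε ⟩
    ε                                 ∎

  square-rectangle : ∀ {p g h} .{{_ : NonZero p}} → HasOrder G (p * p) → p · g ≈ ε → Coordinates p p g h →
                     MagicRectangle G p p
  square-rectangle {p} {g} {h} order pg≈ε coordinates = record
    { entry      = entry
    ; bijective  = array-bijective order entry entry-injective
    ; ω          = T · h
    ; δ          = T · g ∙ T · h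
    ; rowSums    = row
    ; columnSums = column
    }
    where
      open Rotation p
      T : ℕ
      T = Σℕ {p} toℕ
      entry : Fin p → Fin p → Carrier
      entry r c = toℕ r · g ∙ toℕ (rotate r c) · h
      entry-injective : PairInjective entry
      entry-injective {r} {c} {r′} {c′} eq with coordinates-injective coordinates {r} {rotate r c} {r′} {rotate r′ c′} eq
      ... | ≡.refl , rotations≡ = ≡.refl , rotate-injective r rotations≡
      row-rotation : ∀ r → Σℕ (λ c → toℕ (rotate r c)) ≡ T
      row-rotation r = Σ-reindex (rotate r) (rotate-injective r) toℕ
      column-rotation : ∀ c → Σℕ (λ r → toℕ (rotate r c)) ≡ T
      column-rotation c = ≡.trans (ℕΣ.sum-cong-≗ (λ r → ≡.cong toℕ (rotate-comm r c))) (row-rotation c)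
      row : ∀ r → gsum G (entry r) ≈ T · h
      row r = begin
        gsum G (entry r)
          ≈⟨ sum-combination g h (λ _ → toℕ r) (λ c → toℕ (rotate r c)) ⟩
        Σℕ {p} (λ _ → toℕ r) · g ∙ Σℕ (λ c → toℕ (rotate r c)) · h
          ≈⟨ ∙-cong (·-killed (≡.subst (p ∣_) (≡.sym (Σ-const p (toℕ r))) (m∣m*n (toℕ r))) pg≈ε)
                    (×-congˡ (row-rotation r)) ⟩
        ε ∙ T · h                                         ≈⟨ identityˡ _ ⟩
        T · h                                             ∎
      column : ∀ c → gsum G (λ r → entry r c) ≈ T · g ∙ T · h
      column c = trans (sum-combination g h toℕ (λ r → toℕ (rotate r c))) (∙-congˡ (×-congˡ (column-rotation c)))

  rectangle : ∀ {a b} → Prime a → Prime b → a ≢ b → 3 ≤ a → 3 ≤ b → ¬ a ∣ (b ∸ 1) → HasOrder G (a * b) →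
              MagicRectangle G a b
  rectangle {a} {b@(suc b′)} a-prime b-prime a≢b 3≤a 3≤b@(s≤s _) a∤b-1 order = record
    { entry      = entry
    ; bijective  = array-bijective order entry entry-injective
    ; ω          = ε
    ; δ          = ε
    ; rowSums    = row
    ; columnSums = column
    }
    where
      instance _ = prime⇒nonZero a-prime
      open FiniteGroup G order using (element-of-order)
      g-order : ∃ λ g → a · g ≈ ε × ¬ g ≈ ε
      g-order = element-of-order a-prime b-prime a≢b ≡.refl
      h-order : ∃ λ h → b · h ≈ ε × ¬ h ≈ ε
      h-order = element-of-order b-prime a-prime (a≢b ∘ ≡.sym) (NP.*-comm a b)
      g h : Carrier
      g = proj₁ g-order
      h = proj₁ h-order
      ag≈ε : a · g ≈ ε
      ag≈ε = proj₁ (proj₂ g-order)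
      bh≈ε : b · h ≈ ε
      bh≈ε = proj₁ (proj₂ h-order)
      w : Fin b → ℕ
      w = corrected-ones a b
      z : Fin a → ℕ
      z r = unit-weights b (toℕ r)
      entry : Fin a → Fin b → Carrier
      entry r c = (toℕ r * w c) · g ∙ (toℕ c * z r) · h
      row : ∀ r → gsum G (entry r) ≈ ε
      row r = vanishing-sum (λ c → toℕ r * w c) (λ c → toℕ c * z r) ag≈ε bh≈ε
                (∣-Σ-*ˡ (toℕ r) w (Σ-corrected-ones a b′))
                (∣-Σ-*ʳ {n = b} (z r) toℕ (odd⇒∣triangle (odd-prime b-prime 3≤b)))
      column : ∀ c → gsum G (λ r → entry r c) ≈ ε
      column c = vanishing-sum (λ r → toℕ r * w c) (λ r → toℕ c * z r) ag≈ε bh≈ε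
                   (∣-Σ-*ʳ {n = a} (w c) toℕ (odd⇒∣triangle (odd-prime a-prime 3≤a)))
                   (∣-Σ-*ˡ (toℕ c) z (Σ-unit-weights (NP.≤-trans (NP.n≤1+n 2) 3≤b) (odd-prime a-prime 3≤a)))
      g-distinct : ∀ {k} → Coprime a k → ∀ {u v} → u < a → v < a → (u * k) · g ≈ (v * k) · g → u ≡ v
      g-distinct = scaled-distinct a-prime ag≈ε (proj₂ (proj₂ g-order))
      h-distinct : ∀ {r u v} → u < b → v < b → (u * z r) · h ≈ (v * z r) · h → u ≡ v
      h-distinct {r} = scaled-distinct b-prime bh≈ε (proj₂ (proj₂ h-order))
                         (unit⇒coprime b-prime (unit-weights-between 3≤b (toℕ r)))
      -- column 0 is where the h-component vanishes; elsewhere w = 1 and the g-component gives the row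
      positions : ∀ {r r′} c c′ →
                  (toℕ r * w c) · g ≈ (toℕ r′ * w c′) · g × (toℕ c * z r) · h ≈ (toℕ c′ * z r′) · h →
                  r ≡ r′ × c ≡ c′
      positions {r} {r′} Fin.zero Fin.zero (g-parts , _) =
        FP.toℕ-injective (g-distinct (unit⇒coprime a-prime (corrected-ones-between a b′ a∤b-1))
                                     (FP.toℕ<n r) (FP.toℕ<n r′) g-parts) , ≡.refl
      positions {r} {r′} Fin.zero (Fin.suc c′) (_ , h-parts) =
        ⊥-elim (NP.0≢1+n (h-distinct {r′} (s≤s z≤n) (FP.toℕ<n (Fin.suc c′)) h-parts))
      positions {r} {r′} (Fin.suc c) Fin.zero (_ , h-parts) =
        ⊥-elim (NP.0≢1+n (h-distinct {r} (s≤s z≤n) (FP.toℕ<n (Fin.suc c)) (sym h-parts)))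
      positions {r} {r′} (Fin.suc c) (Fin.suc c′) (g-parts , h-parts) =
        same-row (FP.toℕ-injective (g-distinct (coprime-sym (1-coprimeTo a)) (FP.toℕ<n r) (FP.toℕ<n r′) g-parts)) h-parts
        where
          same-row : r ≡ r′ → (toℕ (Fin.suc c) * z r) · h ≈ (toℕ (Fin.suc c′) * z r′) · h →
                     r ≡ r′ × Fin.suc c ≡ Fin.suc c′
          same-row ≡.refl h-parts =
            ≡.refl , FP.toℕ-injective (h-distinct {r} (FP.toℕ<n (Fin.suc c)) (FP.toℕ<n (Fin.suc c′)) h-parts)
      entry-injective : PairInjective entry
      entry-injective {r} {c} {r′} {c′} eq =
        positions c c′ (components {u = toℕ r * w c} {toℕ c * z r} {toℕ r′ * w c′} {toℕ c′ * z r′}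
                          (distinct-primes-coprime a-prime b-prime a≢b) ag≈ε bh≈ε eq)

  square-magic : ∀ {p} → Prime p → HasOrder G (p * p) → MagicRectangle G p p
  square-magic {p} p-prime order with FiniteGroup.square-coordinates G order p-prime ≡.refl
  ... | g , h , pg≈ε , coordinates = square-rectangle {{prime⇒nonZero p-prime}} order pg≈ε coordinates

  distinct-magic : ∀ {a b} → Prime a → Prime b → a ≢ b → 3 ≤ a → 3 ≤ b → HasOrder G (a * b) →
                   MagicRectangle G a b
  distinct-magic {a} {b} a-prime b-prime a≢b 3≤a 3≤b order with a ∣? (b ∸ 1)
  ... | no  a∤b-1 = rectangle a-prime b-prime a≢b 3≤a 3≤b a∤b-1 order
  ... | yes a∣b-1 = transpose (rectangle b-prime a-prime (a≢b ∘ ≡.sym) 3≤b 3≤a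
                      (∣-pred-asymmetric (2≤ 3≤a) (2≤ 3≤b) a∣b-1) (≡.subst (HasOrder G) (NP.*-comm a b) order))
    where
      2≤ : ∀ {x} → 3 ≤ x → 2 ≤ x
      2≤ = NP.≤-trans (NP.n≤1+n 2)

mainTheorem2 : ∀ {c ℓ : Level} (p₁ p₂ : ℕ) → Prime p₁ → Prime p₂ → 3 ≤ p₁ → 3 ≤ p₂ →
                 (Γ : AbelianGroup c ℓ) → HasOrder Γ (p₁ * p₂) → MagicRectangle Γ p₁ p₂
mainTheorem2 p₁ p₂ p₁-prime p₂-prime 3≤p₁ 3≤p₂ Γ order with p₁ ≟ p₂
... | yes ≡.refl = MagicRectangles.square-magic Γ p₁-prime order
... | no  p₁≢p₂  = MagicRectangles.distinct-magic Γ p₁-prime p₂-prime p₁≢p₂ 3≤p₁ 3≤p₂ order
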